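{- Let $k\geq2$. For every $M\in\{1,2,\dots\}\cup\{\infty\}$ and every $N\in\{0,1,2,\dots\}$, the oriented graph $\vec{SW}_{k,N,M}$ and the non-oriented graph $SW_{k,N,M}$ are weakly vertex-transitive (i.e. their automorphism groups, as unlabeled graphs, act transitively on vertices) if and only if $M\geq N$ (with $\infty\ge N$ for all $N$).
   Context: Loops and multiple edges allowed. The oriented spider-web graph $\vec{SW}_{k,N,M}$ has vertex set $\{0,\dots,k-1\}^N\times\mathbb Z/M\mathbb Z$ (with $\mathbb Z/\infty\mathbb Z:=\mathbb Z$) and, for each vertex $(x_1\dots x_N,i)$ and each $y\in\{0,\dots,k-1\}$, one edge labeled $R_y$ from $(x_1\dots x_N,i)$ to $(x_2\dots x_Ny,i+1)$. $SW_{k,N,M}$ is its underlying non-oriented graph (each edge $e$ gets a formal inverse $\bar e$). Weak automorphisms are graph automorphisms that need not preserve labels. -}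

module Defs where

open import Data.Nat using (ℕ; zero; suc; _≤_)
open import Data.Nat.DivMod using (_mod_)
open import Data.Integer as ℤ using (ℤ)
open import Data.Fin using (Fin; toℕ)
open import Data.Vec using (Vec; []; _∷_; _∷ʳ_)
open import Data.Product using (Σ; _×_; _,_; proj₁; proj₂)
open import Data.Sum using (_⊎_; inj₁; inj₂)
open import Data.Unit using (⊤)
open import Function.Bundles using (_↔_; Inverse)
open import Relation.Binary.PropositionalEquality using (_≡_)

-- M ∈ {0,1,2,...} ∪ {∞}; the paper's range M ≥ 1 is imposed as a hypothesis.
data ℕ∞ : Set where
  fin : ℕ → ℕ∞
  ∞   : ℕ∞

_≥∞_ : ℕ∞ → ℕ → Set
fin m ≥∞ n = n ≤ m
∞     ≥∞ n = ⊤

ZMod : ℕ∞ → Set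
ZMod (fin m) = Fin m
ZMod ∞       = ℤ

sucMod : (M : ℕ∞) → ZMod M → ZMod M
sucMod (fin (suc m)) i = suc (toℕ i) mod suc m
sucMod ∞ i = ℤ.suc i

shift : {A : Set} {N : ℕ} → Vec A N → A → Vec A N
shift []       y = []
shift (x ∷ xs) y = xs ∷ʳ y

-- Multigraphs with loops and multiple edges: directed (quiver) presentation
record Quiver : Set₁ where
  field
    V   : Set
    E   : Set
    src : E → V
    tgt : E → V
open Quiver

-- Oriented spider-web graph SW_{k,N,M}: the edge labelled R_y from vertex v
-- is represented by the pair (v , y).
SWV : ℕ → ℕ → ℕ∞ → Set
SWV k N M = Vec (Fin k) N × ZMod M

SW⃗ : ℕ → ℕ → ℕ∞ → Quiver
SW⃗ k N M = record
  { V   = SWV k N M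
  ; E   = SWV k N M × Fin k
  ; src = proj₁
  ; tgt = λ { ((x , i) , y) → (shift x y , sucMod M i) }
  }

-- Automorphism of an oriented multigraph (labels ignored, i.e. weak automorphism)
record DiAut (G : Quiver) : Set where
  field
    onV   : V G ↔ V G
    onE   : E G ↔ E G
    srcOK : ∀ e → src G (Inverse.to onE e) ≡ Inverse.to onV (src G e)
    tgtOK : ∀ e → tgt G (Inverse.to onE e) ≡ Inverse.to onV (tgt G e)

-- Underlying non-oriented graph: darts are edges e (inj₁ e) and their formal
-- inverses ē (inj₂ e).
Dart : Quiver → Set
Dart G = E G ⊎ E G

dsrc : (G : Quiver) → Dart G → V G
dsrc G (inj₁ e) = src G e
dsrc G (inj₂ e) = tgt G e

dtgt : (G : Quiver) → Dart G → V G
dtgt G (inj₁ e) = tgt G e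
dtgt G (inj₂ e) = src G e

bar : (G : Quiver) → Dart G → Dart G
bar G (inj₁ e) = inj₂ e
bar G (inj₂ e) = inj₁ e

-- Automorphism of the underlying non-oriented graph (Serre-style graph with
-- inversion): bijections on vertices and on darts commuting with
-- origin, terminus and inversion.
record UAut (G : Quiver) : Set where
  field
    onV   : V G ↔ V G
    onD   : Dart G ↔ Dart G
    srcOK : ∀ d → dsrc G (Inverse.to onD d) ≡ Inverse.to onV (dsrc G d)
    tgtOK : ∀ d → dtgt G (Inverse.to onD d) ≡ Inverse.to onV (dtgt G d)
    barOK : ∀ d → Inverse.to onD (bar G d) ≡ bar G (Inverse.to onD d)

DiVertexTransitive : Quiver → Set
DiVertexTransitive G =
  ∀ u v → Σ (DiAut G) λ φ → Inverse.to (DiAut.onV φ) u ≡ v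

UVertexTransitive : Quiver → Set
UVertexTransitive G =
  ∀ u v → Σ (UAut G) λ φ → Inverse.to (UAut.onV φ) u ≡ v

module Submission where

-- If M ≥ N (or M = ∞), give the letter at position j of a vertex at level i the time
-- i + j (mod M).  Permuting letters by a permutation that depends only on the time
-- commutes with the shift, hence is an automorphism; since the N positions of a word
-- have distinct times, such a relabelling clears any word to 0…0, and a rotation of
-- the levels does the rest.
--
-- If 1 ≤ M < N, compare u = (0…0, 0) with v = (10…0, 0) in the underlying graph.  A
-- closed walk of length M at v has as many forward as backward darts: the levels
-- force #forward ≡ #backward (mod M), and a walk in one direction only would carry the
-- letter at position 0 of v to position M, where v has a different letter.  No global
-- time exists when M < N, but along a single walk time can be tracked in ℤ; relabelling
-- by the transposition 0 ↔ 1 at time 0 then turns balanced closed walks at v into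
-- balanced closed walks at u.  Composed with an automorphism sending u to v this is an
-- injection of the finite set of walks of length M which keeps closed walks at u closed
-- and makes them balanced; but the forward cycle through 0…0 is a closed unbalanced
-- walk at u lying on a periodic orbit of that injection.

open import Defs
open import Data.Nat using (ℕ; _≤_)
open import Data.Product using (_×_)
open import Function.Bundles using (_⇔_)
open import Relation.Binary.PropositionalEquality using (_≢_)

open import Data.Nat as ℕ using (zero; suc; _+_; _*_; _∸_; _<_; _%_; z≤n; s≤s)
import Data.Nat.Properties as ℕ
open import Data.Nat.DivMod
  using (_mod_; m%n<n; m<n⇒m%n≡m; %-distribˡ-+; m%n%n≡m%n; [m+kn]%n≡m%n; n%n≡0)
open import Data.Nat.GeneralisedArithmetic using (fold; fold-+)
open import Data.Integer as ℤ using (ℤ; +_; _-_; _⊖_)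
import Data.Integer.Properties as ℤ
open import Data.Fin as Fin using (Fin; toℕ)
import Data.Fin.Properties as Fin
open import Data.Fin.Permutation using (Permutation′; _⟨$⟩ʳ_; inverseˡ; flip; transpose)
import Data.Fin.Permutation as Perm
open import Data.Vec as Vec using (Vec; []; _∷_; _∷ʳ_; replicate)
import Data.Vec.Properties as Vec
open import Data.Maybe using (Maybe; just; nothing)
open import Data.Product using (Σ; ∃-syntax; _,_; proj₁; proj₂)
open import Data.Product.Function.NonDependent.Propositional using (_×-↣_; _×-↔_)
open import Data.Sum using (_⊎_; inj₁; inj₂)
open import Data.Sum.Function.Propositional using (_⊎-↣_; _⊎-↔_)
open import Data.Unit using (tt)
open import Data.Empty using (⊥-elim)
open import Function using (_∘_)
open import Function.Bundles using (_↔_; _↣_; mk↔ₛ′; mk↣; mk⇔; Injection; Inverse)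
open import Function.Definitions using (Injective)
open import Function.Construct.Composition using (_↔-∘_; _↣-∘_)
open import Function.Construct.Identity using (↔-id; ↣-id)
open import Function.Construct.Symmetry using (↔-sym)
open import Function.Properties.Inverse using (↔⇒↣)
open import Relation.Binary.PropositionalEquality
open import Relation.Nullary using (¬_)
open import Relation.Nullary.Decidable using (dec-true)

open Quiver using (V; E; tgt)
open Inverse using (to; from; strictlyInverseˡ; strictlyInverseʳ)

private variable
  A B C : Set
  n : ℕ

module _ {G : Quiver} where

  SameOrbit : V G → V G → Set
  SameOrbit u v = Σ (DiAut G) λ φ → to (DiAut.onV φ) u ≡ v

  sameOrbit-trans : ∀ {u v w} → SameOrbit u v → SameOrbit v w → SameOrbit u w
  sameOrbit-trans (φ , refl) (ψ , refl) = aut , refl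
    where
    aut : DiAut G
    aut = record
      { onV = DiAut.onV ψ ↔-∘ DiAut.onV φ
      ; onE = DiAut.onE ψ ↔-∘ DiAut.onE φ
      ; srcOK = λ e → trans (DiAut.srcOK ψ _) (cong (to (DiAut.onV ψ)) (DiAut.srcOK φ e))
      ; tgtOK = λ e → trans (DiAut.tgtOK ψ _) (cong (to (DiAut.onV ψ)) (DiAut.tgtOK φ e))
      }

  sameOrbit-sym : ∀ {u v} → SameOrbit u v → SameOrbit v u
  sameOrbit-sym {u} (φ , refl) = aut , strictlyInverseʳ onV u
    where
    open DiAut φ
    commute : ∀ {f : E G → V G} → (∀ e → f (to onE e) ≡ to onV (f e)) →
              ∀ e → f (from onE e) ≡ from onV (f e)
    commute {f} ok e = begin
      f (from onE e)                       ≡⟨ strictlyInverseʳ onV _ ⟨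
      from onV (to onV (f (from onE e)))   ≡⟨ cong (from onV) (ok (from onE e)) ⟨
      from onV (f (to onE (from onE e)))   ≡⟨ cong (from onV ∘ f) (strictlyInverseˡ onE e) ⟩
      from onV (f e)                       ∎
      where open ≡-Reasoning
    aut : DiAut G
    aut = record
      { onV = ↔-sym onV ; onE = ↔-sym onE
      ; srcOK = commute srcOK ; tgtOK = commute tgtOK }

  base⇒DiVertexTransitive : (b : V G) → (∀ u → SameOrbit u b) → DiVertexTransitive G
  base⇒DiVertexTransitive b reach u v = sameOrbit-trans (reach u) (sameOrbit-sym (reach v))

  DiAut⇒UAut : DiAut G → UAut G
  DiAut⇒UAut φ = record
    { onV = onV
    ; onD = onE ⊎-↔ onE
    ; srcOK = λ { (inj₁ e) → srcOK e ; (inj₂ e) → tgtOK e }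
    ; tgtOK = λ { (inj₁ e) → tgtOK e ; (inj₂ e) → srcOK e }
    ; barOK = λ { (inj₁ e) → refl ; (inj₂ e) → refl }
    }
    where open DiAut φ

  DiVertexTransitive⇒UVertexTransitive : DiVertexTransitive G → UVertexTransitive G
  DiVertexTransitive⇒UVertexTransitive vt u v = let φ , φu≡v = vt u v in DiAut⇒UAut φ , φu≡v

imap : (ℕ → A → B) → Vec A n → Vec B n
imap f []       = []
imap f (x ∷ xs) = f 0 x ∷ imap (f ∘ suc) xs

imap-∷ʳ : ∀ (f : ℕ → A → B) (xs : Vec A n) y → imap f (xs ∷ʳ y) ≡ imap f xs ∷ʳ f n y
imap-∷ʳ f []       y = refl
imap-∷ʳ f (x ∷ xs) y = cong (f 0 x ∷_) (imap-∷ʳ (f ∘ suc) xs y)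

imap-shift : ∀ (f : ℕ → A → B) (xs : Vec A n) y →
             shift (imap f xs) (f n y) ≡ imap (f ∘ suc) (shift xs y)
imap-shift f []       y = refl
imap-shift f (x ∷ xs) y = sym (imap-∷ʳ (f ∘ suc) xs y)

imap-cong< : ∀ {f g : ℕ → A → B} (xs : Vec A n) → (∀ j → j < n → ∀ a → f j a ≡ g j a) →
             imap f xs ≡ imap g xs
imap-cong< []       eq = refl
imap-cong< (x ∷ xs) eq = cong₂ _∷_ (eq 0 (s≤s z≤n) x) (imap-cong< xs λ j j<n → eq (suc j) (s≤s j<n))

imap-∘ : ∀ (f : ℕ → B → C) (g : ℕ → A → B) (xs : Vec A n) →
         imap f (imap g xs) ≡ imap (λ j → f j ∘ g j) xs
imap-∘ f g []       = refl
imap-∘ f g (x ∷ xs) = cong (f 0 (g 0 x) ∷_) (imap-∘ (f ∘ suc) (g ∘ suc) xs)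

imap-id : ∀ {f : ℕ → A → A} (xs : Vec A n) → (∀ j a → f j a ≡ a) → imap f xs ≡ xs
imap-id []       eq = refl
imap-id (x ∷ xs) eq = cong₂ _∷_ (eq 0 x) (imap-id xs (eq ∘ suc))

module _ {k : ℕ} where

  relabel : (ℤ → Permutation′ k) → (ℕ → ℤ) → Vec (Fin k) n → Vec (Fin k) n
  relabel θ t = imap (λ j → θ (t j) ⟨$⟩ʳ_)

  relabel-inverse : ∀ θ t (x : Vec (Fin k) n) → relabel (flip ∘ θ) t (relabel θ t x) ≡ x
  relabel-inverse θ t x = trans (imap-∘ _ _ x) (imap-id x λ j a → inverseˡ (θ (t j)))

  relabel-shift : ∀ θ t t' (x : Vec (Fin k) n) y → (∀ j → t' j ≡ t (suc j)) →
                  shift (relabel θ t x) (θ (t n) ⟨$⟩ʳ y) ≡ relabel θ t' (shift x y)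
  relabel-shift θ t t' x y t'≡ = trans (imap-shift _ x y)
    (imap-cong< (shift x y) λ j _ a → cong (λ s → θ s ⟨$⟩ʳ a) (sym (t'≡ j)))

[m%n+k]%n≡[m+k]%n : ∀ m k n .{{_ : ℕ.NonZero n}} → (m % n + k) % n ≡ (m + k) % n
[m%n+k]%n≡[m+k]%n m k n = begin
  (m % n + k) % n          ≡⟨ %-distribˡ-+ (m % n) k n ⟩
  (m % n % n + k % n) % n  ≡⟨ cong (λ r → (r + k % n) % n) (m%n%n≡m%n m n) ⟩
  (m % n + k % n) % n      ≡⟨ %-distribˡ-+ m k n ⟨
  (m + k) % n              ∎
  where open ≡-Reasoning

equal-residues : ∀ p q d .{{_ : ℕ.NonZero d}} → p + q ≡ d → p % d ≡ q % d →
                 p ≡ 0 ⊎ q ≡ 0 ⊎ p ≡ q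
equal-residues zero    q       d _     _   = inj₁ refl
equal-residues (suc p) zero    d _     _   = inj₂ (inj₁ refl)
equal-residues (suc p) (suc q) d p+q≡d p≡q = inj₂ (inj₂ (begin
  suc p      ≡⟨ m<n⇒m%n≡m p<d ⟨
  suc p % d  ≡⟨ p≡q ⟩
  suc q % d  ≡⟨ m<n⇒m%n≡m q<d ⟩
  suc q      ∎))
  where
  open ≡-Reasoning
  p<d : suc p < d
  p<d = subst (suc p <_) p+q≡d (ℕ.m<m+n (suc p) (s≤s z≤n))
  q<d : suc q < d
  q<d = subst (suc q <_) (trans (ℕ.+-comm (suc q) (suc p)) p+q≡d) (ℕ.m<m+n (suc q) (s≤s z≤n))

module _ {m : ℕ} where

  rotate : ℕ → Fin (suc m) → Fin (suc m)
  rotate c i = (toℕ i + c) mod suc m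

  toℕ-rotate : ∀ c i → toℕ (rotate c i) ≡ (toℕ i + c) % suc m
  toℕ-rotate c i = Fin.toℕ-fromℕ< (m%n<n (toℕ i + c) (suc m))

  rotate-rotate : ∀ c d i → rotate c (rotate d i) ≡ rotate (d + c) i
  rotate-rotate c d i = Fin.toℕ-injective (begin
    toℕ (rotate c (rotate d i))        ≡⟨ toℕ-rotate c (rotate d i) ⟩
    (toℕ (rotate d i) + c) % suc m     ≡⟨ cong (λ r → (r + c) % suc m) (toℕ-rotate d i) ⟩
    ((toℕ i + d) % suc m + c) % suc m  ≡⟨ [m%n+k]%n≡[m+k]%n (toℕ i + d) c (suc m) ⟩
    (toℕ i + d + c) % suc m            ≡⟨ cong (_% suc m) (ℕ.+-assoc (toℕ i) d c) ⟩
    (toℕ i + (d + c)) % suc m          ≡⟨ toℕ-rotate (d + c) i ⟨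
    toℕ (rotate (d + c) i)             ∎)
    where open ≡-Reasoning

  rotate-period : ∀ c i → rotate (c * suc m) i ≡ i
  rotate-period c i = Fin.toℕ-injective (begin
    toℕ (rotate (c * suc m) i)    ≡⟨ toℕ-rotate (c * suc m) i ⟩
    (toℕ i + c * suc m) % suc m   ≡⟨ [m+kn]%n≡m%n (toℕ i) c (suc m) ⟩
    toℕ i % suc m                 ≡⟨ m<n⇒m%n≡m (Fin.toℕ<n i) ⟩
    toℕ i                         ∎)
    where open ≡-Reasoning

  rotate-toZero : ∀ i → rotate (suc m ∸ toℕ i) i ≡ Fin.zero
  rotate-toZero i = Fin.toℕ-injective (begin
    toℕ (rotate (suc m ∸ toℕ i) i)     ≡⟨ toℕ-rotate _ i ⟩
    (toℕ i + (suc m ∸ toℕ i)) % suc m  ≡⟨ cong (_% suc m) (ℕ.m+[n∸m]≡n (ℕ.<⇒≤ (Fin.toℕ<n i))) ⟩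
    suc m % suc m                      ≡⟨ n%n≡0 (suc m) ⟩
    0                                  ∎)
    where open ≡-Reasoning

  sucMod≡rotate1 : ∀ i → sucMod (fin (suc m)) i ≡ rotate 1 i
  sucMod≡rotate1 i = cong (_mod suc m) (ℕ.+-comm 1 (toℕ i))

  rotate-sucMod : ∀ c i → rotate c (sucMod (fin (suc m)) i) ≡ sucMod (fin (suc m)) (rotate c i)
  rotate-sucMod c i = begin
    rotate c (sucMod _ i)    ≡⟨ cong (rotate c) (sucMod≡rotate1 i) ⟩
    rotate c (rotate 1 i)    ≡⟨ rotate-rotate c 1 i ⟩
    rotate (1 + c) i         ≡⟨ cong (λ r → rotate r i) (ℕ.+-comm 1 c) ⟩
    rotate (c + 1) i         ≡⟨ rotate-rotate 1 c i ⟨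
    rotate 1 (rotate c i)    ≡⟨ sucMod≡rotate1 (rotate c i) ⟨
    sucMod _ (rotate c i)    ∎
    where open ≡-Reasoning

  fold-sucMod : ∀ i n → fold i (sucMod (fin (suc m))) n ≡ rotate n i
  fold-sucMod i zero    = sym (rotate-period 0 i)
  fold-sucMod i (suc n) = begin
    sucMod _ (fold i (sucMod _) n)  ≡⟨ cong (sucMod _) (fold-sucMod i n) ⟩
    sucMod _ (rotate n i)           ≡⟨ sucMod≡rotate1 (rotate n i) ⟩
    rotate 1 (rotate n i)           ≡⟨ rotate-rotate 1 n i ⟩
    rotate (n + 1) i                ≡⟨ cong (λ r → rotate r i) (ℕ.+-comm n 1) ⟩
    rotate (suc n) i                ∎
    where open ≡-Reasoning

  rotation : ℕ → Fin (suc m) ↔ Fin (suc m)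
  rotation c = mk↔ₛ′ (rotate c) (rotate (c * m))
    (λ i → trans (rotate-rotate c (c * m) i)
             (trans (cong (λ r → rotate r i) (trans (ℕ.+-comm (c * m) c) (sym (ℕ.*-suc c m))))
                    (rotate-period c i)))
    (λ i → trans (rotate-rotate (c * m) c i)
             (trans (cong (λ r → rotate r i) (sym (ℕ.*-suc c m))) (rotate-period c i)))

[i+j]+k≡i : ∀ i {j k} → j ℤ.+ k ≡ + 0 → i ℤ.+ j ℤ.+ k ≡ i
[i+j]+k≡i i {j} {k} j+k≡0 =
  trans (ℤ.+-assoc i j k) (trans (cong (λ r → i ℤ.+ r) j+k≡0) (ℤ.+-identityʳ i))

translation : ℤ → ℤ ↔ ℤ
translation c = mk↔ₛ′ (ℤ._+ c) (_- c)
  (λ i → [i+j]+k≡i i (ℤ.+-inverseˡ c)) (λ i → [i+j]+k≡i i (ℤ.+-inverseʳ c))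

fold-init : ∀ (x : A) s n → fold (s x) s n ≡ s (fold x s n)
fold-init x s n = trans (sym (fold-+ x s n {1})) (cong (fold x s) (ℕ.+-comm n 1))

-- Relabelling and level-shifting automorphisms

-- The letter at position j of a vertex at level i is the one written at time i + j.
clock : (M : ℕ∞) → ZMod M → ℕ → ℤ
clock (fin (suc m)) i j = + ((toℕ i + j) % suc m)
clock ∞             i j = i ℤ.+ + j

clock-sucMod : ∀ M i j → clock M (sucMod M i) j ≡ clock M i (suc j)
clock-sucMod (fin (suc m)) i j = cong +_ (begin
  (toℕ (suc (toℕ i) mod suc m) + j) % suc m
    ≡⟨ cong (λ r → (r + j) % suc m) (Fin.toℕ-fromℕ< (m%n<n (suc (toℕ i)) (suc m))) ⟩
  (suc (toℕ i) % suc m + j) % suc m  ≡⟨ [m%n+k]%n≡[m+k]%n (suc (toℕ i)) j (suc m) ⟩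
  (suc (toℕ i) + j) % suc m          ≡⟨ cong (_% suc m) (ℕ.+-suc (toℕ i) j) ⟨
  (toℕ i + suc j) % suc m            ∎)
  where open ≡-Reasoning
clock-sucMod ∞ i j = begin
  ℤ.suc i ℤ.+ + j      ≡⟨ cong (ℤ._+ + j) (ℤ.+-comm (+ 1) i) ⟩
  i ℤ.+ + 1 ℤ.+ + j    ≡⟨ ℤ.+-assoc i (+ 1) (+ j) ⟩
  i ℤ.+ + suc j        ∎
  where open ≡-Reasoning

module _ {k N : ℕ} {M : ℕ∞} where

  relabelVertex : (ℤ → Permutation′ k) → (ZMod M → ℕ → ℤ) → SWV k N M → SWV k N M
  relabelVertex θ τ (x , i) = relabel θ (τ i) x , i

  relabelEdge : (ℤ → Permutation′ k) → (ZMod M → ℕ → ℤ) → E (SW⃗ k N M) → E (SW⃗ k N M)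
  relabelEdge θ τ ((x , i) , y) = relabelVertex θ τ (x , i) , θ (τ i N) ⟨$⟩ʳ y

  relabelVertex-inverse : ∀ θ τ v → relabelVertex (flip ∘ θ) τ (relabelVertex θ τ v) ≡ v
  relabelVertex-inverse θ τ (x , i) = cong (_, i) (relabel-inverse θ (τ i) x)

  relabelEdge-inverse : ∀ θ τ e → relabelEdge (flip ∘ θ) τ (relabelEdge θ τ e) ≡ e
  relabelEdge-inverse θ τ ((x , i) , y) =
    cong₂ _,_ (relabelVertex-inverse θ τ (x , i)) (inverseˡ (θ (τ i N)))

  relabelEdge-tgt : ∀ θ τ τ' x i y → (∀ j → τ' (sucMod M i) j ≡ τ i (suc j)) →
                    tgt (SW⃗ k N M) (relabelEdge θ τ ((x , i) , y)) ≡
                    relabelVertex θ τ' (tgt (SW⃗ k N M) ((x , i) , y))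
  relabelEdge-tgt θ τ τ' x i y τ'≡ =
    cong (_, sucMod M i) (relabel-shift θ (τ i) (τ' (sucMod M i)) x y τ'≡)

module _ {k N : ℕ} (M : ℕ∞) where

  relabelAut : (ℤ → Permutation′ k) → DiAut (SW⃗ k N M)
  relabelAut θ = record
    { onV = mk↔ₛ′ (relabelVertex θ τ) (relabelVertex (flip ∘ θ) τ)
                  (relabelVertex-inverse (flip ∘ θ) τ) (relabelVertex-inverse θ τ)
    ; onE = mk↔ₛ′ (relabelEdge θ τ) (relabelEdge (flip ∘ θ) τ)
                  (relabelEdge-inverse (flip ∘ θ) τ) (relabelEdge-inverse θ τ)
    ; srcOK = λ _ → refl
    ; tgtOK = λ { ((x , i) , y) → relabelEdge-tgt θ τ τ x i y (clock-sucMod M i) }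
    }
    where τ = clock M

  levelAut : (β : ZMod M ↔ ZMod M) → (∀ i → to β (sucMod M i) ≡ sucMod M (to β i)) →
             DiAut (SW⃗ k N M)
  levelAut β β-sucMod = record
    { onV = ↔-id _ ×-↔ β
    ; onE = (↔-id _ ×-↔ β) ×-↔ ↔-id _
    ; srcOK = λ _ → refl
    ; tgtOK = λ { ((x , i) , y) → cong (shift x y ,_) (sym (β-sucMod i)) }
    }

module _ {k N : ℕ} where

  rotate-sameOrbit : ∀ {m} x (l : Fin (suc m)) →
                     SameOrbit {SW⃗ k N (fin (suc m))} (x , l) (x , Fin.zero)
  rotate-sameOrbit x l = levelAut _ (rotation c) (rotate-sucMod c) , cong (x ,_) (rotate-toZero l)
    where c = _ ∸ toℕ l

  translate-sameOrbit : ∀ x l → SameOrbit {SW⃗ k N ∞} (x , l) (x , + 0)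
  translate-sameOrbit x l =
    levelAut _ (translation (ℤ.- l)) (λ i → ℤ.+-assoc (+ 1) i (ℤ.- l)) , cong (x ,_) (ℤ.+-inverseʳ l)

clearing : ∀ {k} → Vec (Fin (suc k)) n → ℤ → Permutation′ (suc k)
clearing (a ∷ xs) (+ zero)  = transpose a Fin.zero
clearing (a ∷ xs) (+ suc j) = clearing xs (+ j)
clearing _        _         = Perm.id

transpose-self : ∀ {n} (i j : Fin n) → transpose i j ⟨$⟩ʳ i ≡ j
transpose-self i j rewrite dec-true (i Fin.≟ i) refl = refl

relabel-clearing : ∀ {k} (x : Vec (Fin (suc k)) n) → relabel (clearing x) +_ x ≡ replicate n Fin.zero
relabel-clearing []       = refl
relabel-clearing (a ∷ xs) = cong₂ _∷_ (transpose-self a Fin.zero) (relabel-clearing xs)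

clear-sameOrbit : ∀ {k N} M (l₀ : ZMod M) → (∀ j → j < N → clock M l₀ j ≡ + j) →
                  ∀ x → SameOrbit {SW⃗ (suc k) N M} (x , l₀) (replicate N Fin.zero , l₀)
clear-sameOrbit M l₀ clock≡ x = relabelAut M (clearing x) , cong (_, l₀) (begin
  relabel (clearing x) (clock M l₀) x
    ≡⟨ imap-cong< x (λ j j<N a → cong (λ t → clearing x t ⟨$⟩ʳ a) (clock≡ j j<N)) ⟩
  relabel (clearing x) +_ x   ≡⟨ relabel-clearing x ⟩
  replicate _ Fin.zero        ∎)
  where open ≡-Reasoning

sufficiency : ∀ {k N} M → M ≢ fin 0 → M ≥∞ N → DiVertexTransitive (SW⃗ (suc k) N M)
sufficiency (fin zero)    M≢0 _   = ⊥-elim (M≢0 refl)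
sufficiency (fin (suc m)) _   N≤M =
  base⇒DiVertexTransitive (replicate _ Fin.zero , Fin.zero) λ (x , l) →
    sameOrbit-trans (rotate-sameOrbit x l)
      (clear-sameOrbit _ Fin.zero (λ j j<N → cong +_ (m<n⇒m%n≡m (ℕ.<-≤-trans j<N N≤M))) x)
sufficiency ∞             _   _   =
  base⇒DiVertexTransitive (replicate _ Fin.zero , + 0) λ (x , l) →
    sameOrbit-trans (translate-sameOrbit x l) (clear-sameOrbit ∞ (+ 0) (λ _ _ → refl) x)

Finite : Set → Set
Finite A = Σ ℕ λ size → A ↣ Fin size

finite-Fin : Finite (Fin n)
finite-Fin = _ , ↣-id _

finite-× : Finite A → Finite B → Finite (A × B)
finite-× (_ , f) (_ , g) = _ , ↔⇒↣ (↔-sym Fin.*↔×) ↣-∘ (f ×-↣ g)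

finite-⊎ : Finite A → Finite B → Finite (A ⊎ B)
finite-⊎ (_ , f) (_ , g) = _ , ↔⇒↣ (↔-sym Fin.+↔⊎) ↣-∘ (f ⊎-↣ g)

finite-Vec : Finite A → Finite (Vec A n)
finite-Vec {n = zero}  _  = 1 , mk↣ {to = λ _ → Fin.zero} λ { {[]} {[]} _ → refl }
finite-Vec {n = suc n} fA = _ , proj₂ (finite-× fA (finite-Vec fA)) ↣-∘ mk↣ uncons-injective
  where
  uncons-injective : Injective _≡_ _≡_ (Vec.uncons {n = n})
  uncons-injective {_ ∷ _} {_ ∷ _} refl = refl

map-injective : ∀ {f : A → B} → Injective _≡_ _≡_ f → Injective _≡_ _≡_ (Vec.map {n = n} f)
map-injective f-inj {[]}     {[]}     _  = refl
map-injective f-inj {x ∷ xs} {y ∷ ys} eq =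
  cong₂ _∷_ (f-inj (Vec.∷-injectiveˡ eq)) (map-injective f-inj (Vec.∷-injectiveʳ eq))

fold-injective : ∀ {g : A → A} → Injective _≡_ _≡_ g → ∀ n {x y} → fold x g n ≡ fold y g n → x ≡ y
fold-injective g-inj zero    eq = eq
fold-injective g-inj (suc n) eq = fold-injective g-inj n (g-inj eq)

injective⇒recurrent : Finite A → ∀ {g : A → A} → Injective _≡_ _≡_ g →
                      ∀ x → ∃[ c ] x ≡ g (fold x g c)
injective⇒recurrent (size , enc) {g} g-inj x
  with i , j , i<j , eq ← Fin.pigeonhole (ℕ.n<1+n size) (λ t → Injection.to enc (fold x g (toℕ t)))
  = c , fold-injective g-inj (toℕ i) (begin
      fold x g (toℕ i)                  ≡⟨ Injection.injective enc eq ⟩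
      fold x g (toℕ j)                  ≡⟨ cong (fold x g) j≡i+[1+c] ⟩
      fold x g (toℕ i + suc c)          ≡⟨ fold-+ x g (toℕ i) ⟩
      fold (g (fold x g c)) g (toℕ i)   ∎)
  where
  c = toℕ j ∸ suc (toℕ i)
  j≡i+[1+c] : toℕ j ≡ toℕ i + suc c
  j≡i+[1+c] = trans (sym (ℕ.m+[n∸m]≡n i<j)) (sym (ℕ.+-suc (toℕ i) c))
  open ≡-Reasoning

module _ (G : Quiver) where

  Walk : V G → Vec (Dart G) n → V G → Set
  Walk a []       b = a ≡ b
  Walk a (d ∷ ds) b = dsrc G d ≡ a × Walk (dtgt G d) ds b

UAut-walk : ∀ {G} (φ : UAut G) {a b} {ds : Vec (Dart G) n} → Walk G a ds b →
            Walk G (to (UAut.onV φ) a) (Vec.map (to (UAut.onD φ)) ds) (to (UAut.onV φ) b)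
UAut-walk φ {ds = []}     refl       = refl
UAut-walk φ {ds = d ∷ ds} (refl , w) =
  UAut.srcOK φ d , subst (λ a → Walk _ a _ _) (sym (UAut.tgtOK φ d)) (UAut-walk φ w)

forwards backwards : Vec (A ⊎ B) n → ℕ
forwards []            = 0
forwards (inj₁ _ ∷ ds) = suc (forwards ds)
forwards (inj₂ _ ∷ ds) = forwards ds
backwards []            = 0
backwards (inj₁ _ ∷ ds) = backwards ds
backwards (inj₂ _ ∷ ds) = suc (backwards ds)

forwards+backwards : ∀ (ds : Vec (A ⊎ B) n) → forwards ds + backwards ds ≡ n
forwards+backwards []            = refl
forwards+backwards (inj₁ _ ∷ ds) = cong suc (forwards+backwards ds)
forwards+backwards (inj₂ _ ∷ ds) =
  trans (ℕ.+-suc (forwards ds) (backwards ds)) (cong suc (forwards+backwards ds))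

step : A ⊎ B → ℤ
step (inj₁ _) = ℤ.1ℤ
step (inj₂ _) = ℤ.-1ℤ

displacement : Vec (A ⊎ B) n → ℤ
displacement []       = + 0
displacement (d ∷ ds) = step d ℤ.+ displacement ds

displacement≡forwards⊖backwards : ∀ (ds : Vec (A ⊎ B) n) → displacement ds ≡ forwards ds ⊖ backwards ds
displacement≡forwards⊖backwards [] = refl
displacement≡forwards⊖backwards (inj₁ _ ∷ ds) =
  trans (cong (ℤ._+_ ℤ.1ℤ) (displacement≡forwards⊖backwards ds))
        (ℤ.distribʳ-⊖-+-pos 1 (forwards ds) (backwards ds))
displacement≡forwards⊖backwards (inj₂ _ ∷ ds) =
  trans (cong (ℤ._+_ ℤ.-1ℤ) (displacement≡forwards⊖backwards ds))
        (ℤ.distribʳ-⊖-+-neg 0 (forwards ds) (backwards ds))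

level-invariant : ∀ {k N M a b} {ds : Vec (Dart (SW⃗ k N M)) n} → Walk (SW⃗ k N M) a ds b →
                  fold (proj₂ a) (sucMod M) (forwards ds) ≡ fold (proj₂ b) (sucMod M) (backwards ds)
level-invariant {ds = []} refl = refl
level-invariant {M = M} {ds = inj₁ ((x , i) , y) ∷ ds} (refl , w) =
  trans (sym (fold-init i (sucMod M) (forwards ds))) (level-invariant w)
level-invariant {M = M} {ds = inj₂ ((x , i) , y) ∷ ds} (refl , w) =
  trans (fold-init i (sucMod M) (forwards ds)) (cong (sucMod M) (level-invariant w))

letter : Vec A n → ℕ → Maybe A
letter []       _       = nothing
letter (x ∷ _)  zero    = just x
letter (_ ∷ xs) (suc j) = letter xs j

letter-∷ʳ : ∀ (xs : Vec A n) y j → j < n → letter (xs ∷ʳ y) j ≡ letter xs j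
letter-∷ʳ (x ∷ xs) y zero    _         = refl
letter-∷ʳ (x ∷ xs) y (suc j) (s≤s j<n) = letter-∷ʳ xs y j j<n

letter-shift : ∀ (xs : Vec A n) y j → suc j < n → letter (shift xs y) j ≡ letter xs (suc j)
letter-shift (x ∷ xs) y j (s≤s j<n) = letter-∷ʳ xs y j j<n

letter-replicate : ∀ (a : A) j → j < n → letter (replicate n a) j ≡ just a
letter-replicate a zero    (s≤s _)   = refl
letter-replicate a (suc j) (s≤s j<n) = letter-replicate a j j<n

replicate-∷ʳ : ∀ n (a : A) → replicate n a ∷ʳ a ≡ a ∷ replicate n a
replicate-∷ʳ zero    a = refl
replicate-∷ʳ (suc n) a = cong (a ∷_) (replicate-∷ʳ n a)

shift-replicate : ∀ n (a : A) → shift (replicate n a) a ≡ replicate n a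
shift-replicate zero    a = refl
shift-replicate (suc n) a = replicate-∷ʳ n a

module _ {k N : ℕ} {M : ℕ∞} where

  private
    G = SW⃗ k N M

  forward-letters : ∀ {a b} {ds : Vec (Dart G) n} → Walk G a ds b →
                    backwards ds ≡ 0 → ∀ j → j + forwards ds < N →
                    letter (proj₁ b) j ≡ letter (proj₁ a) (j + forwards ds)
  forward-letters {a = a} {ds = []} refl _ j _ = cong (letter (proj₁ a)) (sym (ℕ.+-identityʳ j))
  forward-letters {b = b} {ds = inj₁ ((x , i) , y) ∷ ds} (refl , w) no-back j j+f<N = begin
    letter (proj₁ b) j
      ≡⟨ forward-letters w no-back j (ℕ.<-trans (ℕ.+-monoʳ-< j (ℕ.n<1+n _)) j+f<N) ⟩
    letter (shift x y) (j + forwards ds)  ≡⟨ letter-shift x y _ (subst (_< N) (ℕ.+-suc j _) j+f<N) ⟩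
    letter x (suc (j + forwards ds))      ≡⟨ cong (letter x) (ℕ.+-suc j _) ⟨
    letter x (j + suc (forwards ds))      ∎
    where open ≡-Reasoning

  backward-letters : ∀ {a b} {ds : Vec (Dart G) n} → Walk G a ds b →
                     forwards ds ≡ 0 → ∀ j → j + backwards ds < N →
                     letter (proj₁ a) j ≡ letter (proj₁ b) (j + backwards ds)
  backward-letters {b = b} {ds = []} refl _ j _ = cong (letter (proj₁ b)) (sym (ℕ.+-identityʳ j))
  backward-letters {b = b} {ds = inj₂ ((x , i) , y) ∷ ds} (refl , w) no-fwd j j+b<N = begin
    letter (shift x y) j                       ≡⟨ letter-shift x y j (ℕ.≤-<-trans (ℕ.m≤m+n (suc j) _) 1+j+b<N) ⟩
    letter x (suc j)                           ≡⟨ backward-letters w no-fwd (suc j) 1+j+b<N ⟩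
    letter (proj₁ b) (suc j + backwards ds)    ≡⟨ cong (letter (proj₁ b)) (ℕ.+-suc j _) ⟨
    letter (proj₁ b) (j + suc (backwards ds))  ∎
    where
    open ≡-Reasoning
    1+j+b<N : suc j + backwards ds < N
    1+j+b<N = subst (_< N) (ℕ.+-suc j _) j+b<N

-- Relabelling along a walk

timeFrom : ∀ {M} → ℤ → ZMod M → ℕ → ℤ
timeFrom h _ j = h ℤ.+ + j

module _ {k N : ℕ} {M : ℕ∞} where

  private
    G = SW⃗ k N M

  -- A backward dart starts at the target of its edge, so the edge sits one time unit earlier.
  relabelDart : (ℤ → Permutation′ k) → ℤ → Dart G → Dart G
  relabelDart θ h (inj₁ e) = inj₁ (relabelEdge θ (timeFrom h) e)
  relabelDart θ h (inj₂ e) = inj₂ (relabelEdge θ (timeFrom (h ℤ.+ ℤ.-1ℤ)) e)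

  relabelDart-dsrc : ∀ θ h d → dsrc G (relabelDart θ h d) ≡ relabelVertex θ (timeFrom h) (dsrc G d)
  relabelDart-dsrc θ h (inj₁ e)             = refl
  relabelDart-dsrc θ h (inj₂ ((x , i) , y)) =
    relabelEdge-tgt θ _ _ x i y λ j → sym (ℤ.+-assoc h ℤ.-1ℤ (+ suc j))

  relabelDart-dtgt : ∀ θ h d →
                     dtgt G (relabelDart θ h d) ≡ relabelVertex θ (timeFrom (h ℤ.+ step d)) (dtgt G d)
  relabelDart-dtgt θ h (inj₁ ((x , i) , y)) = relabelEdge-tgt θ _ _ x i y λ j → ℤ.+-assoc h (+ 1) (+ j)
  relabelDart-dtgt θ h (inj₂ e)             = refl

  relabelWalk : (ℤ → Permutation′ k) → ℤ → Vec (Dart G) n → Vec (Dart G) n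
  relabelWalk θ h []       = []
  relabelWalk θ h (d ∷ ds) = relabelDart θ h d ∷ relabelWalk θ (h ℤ.+ step d) ds

  relabelWalk-walk : ∀ θ h {a b} {ds : Vec (Dart G) n} → Walk G a ds b →
                     Walk G (relabelVertex θ (timeFrom h) a) (relabelWalk θ h ds)
                            (relabelVertex θ (timeFrom (h ℤ.+ displacement ds)) b)
  relabelWalk-walk θ h {ds = []} refl =
    cong (λ t → relabelVertex θ (timeFrom t) _) (sym (ℤ.+-identityʳ h))
  relabelWalk-walk θ h {b = b} {ds = d ∷ ds} (refl , w) =
    relabelDart-dsrc θ h d ,
    subst₂ (λ a c → Walk G a (relabelWalk θ (h ℤ.+ step d) ds) (relabelVertex θ (timeFrom c) b))
      (sym (relabelDart-dtgt θ h d)) (ℤ.+-assoc h (step d) (displacement ds))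
      (relabelWalk-walk θ (h ℤ.+ step d) w)

  relabelWalk-inverse : ∀ θ h (ds : Vec (Dart G) n) → relabelWalk (flip ∘ θ) h (relabelWalk θ h ds) ≡ ds
  relabelWalk-inverse θ h []            = refl
  relabelWalk-inverse θ h (inj₁ e ∷ ds) =
    cong₂ _∷_ (cong inj₁ (relabelEdge-inverse θ _ e)) (relabelWalk-inverse θ _ ds)
  relabelWalk-inverse θ h (inj₂ e ∷ ds) =
    cong₂ _∷_ (cong inj₂ (relabelEdge-inverse θ _ e)) (relabelWalk-inverse θ _ ds)

  relabelWalk-injective : ∀ θ h → Injective _≡_ _≡_ (relabelWalk {n = n} θ h)
  relabelWalk-injective θ h {ds} {ds′} eq = begin
    ds                                                 ≡⟨ relabelWalk-inverse θ h ds ⟨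
    relabelWalk (flip ∘ θ) h (relabelWalk θ h ds)      ≡⟨ cong (relabelWalk (flip ∘ θ) h) eq ⟩
    relabelWalk (flip ∘ θ) h (relabelWalk θ h ds′)     ≡⟨ relabelWalk-inverse θ h ds′ ⟩
    ds′                                                ∎
    where open ≡-Reasoning

  forwards-relabelWalk : ∀ θ h (ds : Vec (Dart G) n) → forwards (relabelWalk θ h ds) ≡ forwards ds
  forwards-relabelWalk θ h []            = refl
  forwards-relabelWalk θ h (inj₁ _ ∷ ds) = cong suc (forwards-relabelWalk θ _ ds)
  forwards-relabelWalk θ h (inj₂ _ ∷ ds) = forwards-relabelWalk θ _ ds

  backwards-relabelWalk : ∀ θ h (ds : Vec (Dart G) n) → backwards (relabelWalk θ h ds) ≡ backwards ds
  backwards-relabelWalk θ h []            = refl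
  backwards-relabelWalk θ h (inj₁ _ ∷ ds) = backwards-relabelWalk θ _ ds
  backwards-relabelWalk θ h (inj₂ _ ∷ ds) = cong suc (backwards-relabelWalk θ _ ds)

module _ {k N m : ℕ} where

  private
    G = SW⃗ k N (fin (suc m))

  constantPath : Fin k → Fin (suc m) → (n : ℕ) → Vec (Dart G) n
  constantPath a i zero    = []
  constantPath a i (suc n) = inj₁ ((replicate N a , i) , a) ∷ constantPath a (sucMod _ i) n

  constantPath-walk : ∀ a i n →
                      Walk G (replicate N a , i) (constantPath a i n) (replicate N a , rotate n i)
  constantPath-walk a i zero    = cong (_ ,_) (sym (rotate-period 0 i))
  constantPath-walk a i (suc n) =
    refl , subst₂ (λ x j → Walk G (x , sucMod _ i) (constantPath a (sucMod _ i) n) (replicate N a , j))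
             (sym (shift-replicate N a))
             (trans (cong (rotate n) (sucMod≡rotate1 i)) (rotate-rotate n 1 i))
             (constantPath-walk a (sucMod _ i) n)

  forwards-constantPath : ∀ a i n → forwards (constantPath a i n) ≡ n
  forwards-constantPath a i zero    = refl
  forwards-constantPath a i (suc n) = cong suc (forwards-constantPath a _ n)

  backwards-constantPath : ∀ a i n → backwards (constantPath a i n) ≡ 0
  backwards-constantPath a i zero    = refl
  backwards-constantPath a i (suc n) = backwards-constantPath a _ n

-- The case 1 ≤ M < N

module Necessity {k m N : ℕ} (m<N : m < N) where

  G = SW⃗ (suc (suc k)) (suc N) (fin (suc m))

  u v : V G
  u = replicate (suc N) Fin.zero , Fin.zero
  v = (Fin.suc Fin.zero ∷ replicate N Fin.zero) , Fin.zero

  letters-of-v-differ : ∀ {i} → i ≡ suc m → letter (proj₁ v) 0 ≢ letter (proj₁ v) i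
  letters-of-v-differ refl eq with () ← trans eq (letter-replicate Fin.zero m m<N)

  closed-at-v-balanced : ∀ (ds : Vec (Dart G) (suc m)) → Walk G v ds v → forwards ds ≡ backwards ds
  closed-at-v-balanced ds w
    with equal-residues (forwards ds) (backwards ds) (suc m) (forwards+backwards ds) residues
    where
    residues : forwards ds % suc m ≡ backwards ds % suc m
    residues = begin
      forwards ds % suc m                            ≡⟨ toℕ-rotate (forwards ds) Fin.zero ⟨
      toℕ (rotate (forwards ds) Fin.zero)            ≡⟨ cong toℕ (fold-sucMod Fin.zero (forwards ds)) ⟨
      toℕ (fold Fin.zero (sucMod _) (forwards ds))   ≡⟨ cong toℕ (level-invariant w) ⟩
      toℕ (fold Fin.zero (sucMod _) (backwards ds))  ≡⟨ cong toℕ (fold-sucMod Fin.zero (backwards ds)) ⟩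
      toℕ (rotate (backwards ds) Fin.zero)           ≡⟨ toℕ-rotate (backwards ds) Fin.zero ⟩
      backwards ds % suc m                           ∎
      where open ≡-Reasoning
  ... | inj₁ no-fwd =
    ⊥-elim (letters-of-v-differ b≡1+m
             (backward-letters w no-fwd 0 (subst (_< suc N) (sym b≡1+m) (s≤s m<N))))
    where b≡1+m = trans (sym (cong (_+ backwards ds) no-fwd)) (forwards+backwards ds)
  ... | inj₂ (inj₁ no-back) =
    ⊥-elim (letters-of-v-differ f≡1+m
             (forward-letters w no-back 0 (subst (_< suc N) (sym f≡1+m) (s≤s m<N))))
    where f≡1+m = trans (sym (ℕ.+-identityʳ _))
                    (trans (cong (λ b → forwards ds + b) (sym no-back)) (forwards+backwards ds))
  ... | inj₂ (inj₂ balanced) = balanced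

  swapAtZero : ℤ → Permutation′ (suc (suc k))
  swapAtZero (+ zero) = transpose Fin.zero (Fin.suc Fin.zero)
  swapAtZero _        = Perm.id

  swapAtZero-v : relabelVertex swapAtZero (timeFrom (+ 0)) v ≡ u
  swapAtZero-v = cong (λ x → (Fin.zero ∷ x) , Fin.zero) (imap-id (replicate N Fin.zero) λ _ _ → refl)

  cycle : Vec (Dart G) (suc m)
  cycle = constantPath Fin.zero Fin.zero (suc m)

  cycle-closed : Walk G u cycle u
  cycle-closed = subst (λ i → Walk G u cycle (_ , i)) (rotate-toZero Fin.zero)
                   (constantPath-walk Fin.zero Fin.zero (suc m))

  cycle-unbalanced : forwards cycle ≢ backwards cycle
  cycle-unbalanced eq with () ← trans (sym (forwards-constantPath _ _ (suc m)))
                                      (trans eq (backwards-constantPath _ _ (suc m)))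

  finite-walks : Finite (Vec (Dart G) (suc m))
  finite-walks = finite-Vec (finite-⊎ edges edges)
    where edges = finite-× (finite-× (finite-Vec finite-Fin) finite-Fin) finite-Fin

  module _ (φ : UAut G) (φu≡v : to (UAut.onV φ) u ≡ v) where

    transport : Vec (Dart G) (suc m) → Vec (Dart G) (suc m)
    transport = relabelWalk swapAtZero (+ 0) ∘ Vec.map (to (UAut.onD φ))

    transport-injective : Injective _≡_ _≡_ transport
    transport-injective =
      map-injective (Injection.injective (↔⇒↣ (UAut.onD φ))) ∘ relabelWalk-injective swapAtZero (+ 0)

    image-at-v : ∀ {ds : Vec (Dart G) (suc m)} → Walk G u ds u →
                 Walk G v (Vec.map (to (UAut.onD φ)) ds) v
    image-at-v {ds} w = subst (λ a → Walk G a (Vec.map (to (UAut.onD φ)) ds) a) φu≡v (UAut-walk φ w)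

    transport-closed : ∀ ds → Walk G u ds u → Walk G u (transport ds) u
    transport-closed ds w =
      subst₂ (λ a b → Walk G a (transport ds) b) swapAtZero-v
        (trans (cong (λ h → relabelVertex swapAtZero (timeFrom (+ 0 ℤ.+ h)) v) no-displacement)
               swapAtZero-v)
        (relabelWalk-walk swapAtZero (+ 0) (image-at-v w))
      where
      ds′ = Vec.map (to (UAut.onD φ)) ds
      no-displacement : displacement ds′ ≡ + 0
      no-displacement = begin
        displacement ds′               ≡⟨ displacement≡forwards⊖backwards ds′ ⟩
        forwards ds′ ⊖ backwards ds′   ≡⟨ cong (_⊖ backwards ds′) (closed-at-v-balanced ds′ (image-at-v w)) ⟩
        backwards ds′ ⊖ backwards ds′  ≡⟨ ℤ.n⊖n≡0 (backwards ds′) ⟩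
        + 0                            ∎
        where open ≡-Reasoning

    transport-balanced : ∀ ds → Walk G u ds u → forwards (transport ds) ≡ backwards (transport ds)
    transport-balanced ds w = begin
      forwards (transport ds)   ≡⟨ forwards-relabelWalk swapAtZero (+ 0) ds′ ⟩
      forwards ds′              ≡⟨ closed-at-v-balanced ds′ (image-at-v w) ⟩
      backwards ds′             ≡⟨ backwards-relabelWalk swapAtZero (+ 0) ds′ ⟨
      backwards (transport ds)  ∎
      where
      ds′ = Vec.map (to (UAut.onD φ)) ds
      open ≡-Reasoning

    iterates-closed : ∀ c → Walk G u (fold cycle transport c) u
    iterates-closed zero    = cycle-closed
    iterates-closed (suc c) = transport-closed (fold cycle transport c) (iterates-closed c)

    cycle-balanced : forwards cycle ≡ backwards cycle
    cycle-balanced = recurrent⇒balanced (injective⇒recurrent finite-walks transport-injective cycle)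
      where
      recurrent⇒balanced : ∃[ c ] cycle ≡ transport (fold cycle transport c) →
                           forwards cycle ≡ backwards cycle
      recurrent⇒balanced (c , cycle≡) = subst (λ ds → forwards ds ≡ backwards ds) (sym cycle≡)
        (transport-balanced (fold cycle transport c) (iterates-closed c))

  ¬UVertexTransitive : ¬ UVertexTransitive G
  ¬UVertexTransitive vt = let φ , φu≡v = vt u v in cycle-unbalanced (cycle-balanced φ φu≡v)

necessity : ∀ {k N} M → M ≢ fin 0 → UVertexTransitive (SW⃗ (suc (suc k)) N M) → M ≥∞ N
necessity (fin zero)    M≢0 _  = ⊥-elim (M≢0 refl)
necessity (fin (suc m)) _   vt = ℕ.≮⇒≥ λ { (s≤s m<N) → Necessity.¬UVertexTransitive m<N vt }
necessity ∞             _   _  = tt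

theorem6p11 : (k : ℕ) → 2 ≤ k → (M : ℕ∞) → M ≢ fin 0 → (N : ℕ) →
    (DiVertexTransitive (SW⃗ k N M) ⇔ (M ≥∞ N))
      × (UVertexTransitive (SW⃗ k N M) ⇔ (M ≥∞ N))
theorem6p11 (suc (suc k)) (s≤s (s≤s z≤n)) M M≢0 N =
  mk⇔ (necessity M M≢0 ∘ DiVertexTransitive⇒UVertexTransitive) (sufficiency M M≢0) ,
  mk⇔ (necessity M M≢0) (DiVertexTransitive⇒UVertexTransitive ∘ sufficiency M M≢0)
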